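{- Let $\mathcal{C}$ be a target–context category with intrinsic behaviors (behavior object $B$, shadow functor $\Phi$, behavioral preorder $\succeq$ on $\overline{B}=\Phi(B)$). If there is a morphism $F\colon C\otimes C\to B$ that is an $A$-complete parametrization of maps $C\to B$ for some object $A$, then every morphism $g\colon B\to B$ has a quasi-fixed point, i.e. there is a morphism $b$ with codomain $B$ such that $\overline{b}\succeq^{\rm im}\overline{g}\circ\overline{b}$.
   Context: $\mathcal{C}$ is a gs-monoidal category (symmetric monoidal with tensor $\otimes$, unit $I$, and commutative comonoids $\mathrm{copy}_A\colon A\to A\otimes A$, $\mathrm{del}_A\colon A\to I$ on every object, compatible with $\otimes$, $\mathrm{del}_I=\mathrm{id}_I$), all of whose morphisms $f\colon A\to X$ are normalized: $f\circ\mathrm{dom}(f)=f$ where $\mathrm{dom}(f)=(\mathrm{id}_A\otimes(\mathrm{del}_X\circ f))\circ\mathrm{copy}_A$. A morphism $f$ is functional if $\mathrm{copy}_X\circ f=(f\otimes f)\circ\mathrm{copy}_A$. $\mathbf{Rel}$ is the category of sets and relations (tensor = cartesian product, $\mathrm{copy}(a)=\{(a,a)\}$, $\mathrm{del}$ the full relation to a singleton). A lax gs-monoidal functor $\Phi\colon\mathcal{C}\to\mathbf{Rel}$ is a lax symmetric monoidal functor with structure maps $\psi_0,\psi_{A,B}$ such that $\Phi(\mathrm{copy}_A)=\psi_{A,A}\circ\mathrm{copy}_{\Phi A}$ and $\Phi(\mathrm{del}_A)=\psi_0\circ\mathrm{del}_{\Phi A}$. Write $\overline{X}=\Phi(X)$,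 $\overline f=\Phi(f)$. Imitation: for a preordered set $(X,\succeq)$ and relations $\nu,\mu\colon A\to X$, $\nu\succeq^{\rm im}\mu$ iff for every $a$ with $\mu(a)\neq\emptyset$ there exist functions $\mathrm{enh}\colon\mu(a)\to\nu(a)$ with $\mathrm{enh}(u)\succeq u$ for all $u$ and $\mathrm{deg}\colon\nu(a)\to\mu(a)$ with $v\succeq\mathrm{deg}(v)$ for all $v$. A target–context category with intrinsic behaviors consists of such $\mathcal{C}$, objects $T,C,B$, a morphism $\mathrm{eval}\colon T\otimes C\to B$ such that $\overline{\mathrm{eval}}$ is a function, a lax gs-monoidal functor $\Phi\colon\mathcal{C}\to\mathbf{Rel}$ and a preorder $\succeq$ on $\overline{B}$; the ambient relation on $\mathcal{C}(A,T\otimes C)$ is $f\succeq g$ iff $\overline{\mathrm{eval}}\circ\overline f\succeq^{\rm im}\overline{\mathrm{eval}}\circ\overline g$, and it is required that $f\sqsupseteq g$ (i.e. $f\circ\mathrm{dom}(g)=g$) implies $f\succeq g$ and $f\succeq g$ implies $f\circ h\succeq g\circ h$. A morphism $F\colon P\otimes C\to B$ is an $A$-complete parametrization of maps $C\to B$ if for every $f\colon A\otimes C\to B$ there is a functional $p_f\colon A\to P$ with $\overline{F\circ(p_f\otimes\mathrm{id}_C)}\succeq^{\rm im}\overline{f}$. -}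

module Defs where

open import Level using (Level; _⊔_) renaming (suc to lsuc)
open import Data.Product using (Σ; Σ-syntax; _×_; _,_; proj₁; proj₂; ∃; swap)
open import Data.Unit using (⊤; tt)
open import Function using (_⇔_)
open import Relation.Binary.PropositionalEquality using (_≡_)

record Category (o h : Level) : Set (lsuc (o ⊔ h)) where
  infixr 9 _∘_
  infix 4 _⇒_
  field
    Obj : Set o
    _⇒_ : Obj → Obj → Set h
    id : ∀ {A} → A ⇒ A
    _∘_ : ∀ {A B C} → B ⇒ C → A ⇒ B → A ⇒ C
    identityˡ : ∀ {A B} {f : A ⇒ B} → id ∘ f ≡ f
    identityʳ : ∀ {A B} {f : A ⇒ B} → f ∘ id ≡ f
    assoc : ∀ {A B C D} {f : A ⇒ B} {g : B ⇒ C} {k : C ⇒ D} →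
            (k ∘ g) ∘ f ≡ k ∘ (g ∘ f)

record GSMonoidalCategory (o h : Level) : Set (lsuc (o ⊔ h)) where
  field
    category : Category o h
  open Category category public
  infixr 10 _⊗₀_ _⊗₁_
  field
    _⊗₀_ : Obj → Obj → Obj
    I : Obj
    _⊗₁_ : ∀ {A B C D} → A ⇒ B → C ⇒ D → (A ⊗₀ C) ⇒ (B ⊗₀ D)
    ⊗-id : ∀ {A B} → id {A} ⊗₁ id {B} ≡ id
    ⊗-∘ : ∀ {A B C D E F} {f : A ⇒ B} {g : B ⇒ C} {p : D ⇒ E} {q : E ⇒ F} →
          (g ∘ f) ⊗₁ (q ∘ p) ≡ (g ⊗₁ q) ∘ (f ⊗₁ p)
    α⇒ : ∀ {A B C} → (A ⊗₀ B) ⊗₀ C ⇒ A ⊗₀ (B ⊗₀ C)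
    α⇐ : ∀ {A B C} → A ⊗₀ (B ⊗₀ C) ⇒ (A ⊗₀ B) ⊗₀ C
    α-isoˡ : ∀ {A B C} → α⇐ ∘ α⇒ {A} {B} {C} ≡ id
    α-isoʳ : ∀ {A B C} → α⇒ ∘ α⇐ {A} {B} {C} ≡ id
    α-natural : ∀ {A A′ B B′ C C′} {f : A ⇒ A′} {g : B ⇒ B′} {k : C ⇒ C′} →
                α⇒ ∘ ((f ⊗₁ g) ⊗₁ k) ≡ (f ⊗₁ (g ⊗₁ k)) ∘ α⇒
    λ⇒ : ∀ {A} → I ⊗₀ A ⇒ A
    λ⇐ : ∀ {A} → A ⇒ I ⊗₀ A
    λ-isoˡ : ∀ {A} → λ⇐ ∘ λ⇒ {A} ≡ id
    λ-isoʳ : ∀ {A} → λ⇒ ∘ λ⇐ {A} ≡ id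
    λ-natural : ∀ {A A′} {f : A ⇒ A′} → λ⇒ ∘ (id ⊗₁ f) ≡ f ∘ λ⇒
    ρ⇒ : ∀ {A} → A ⊗₀ I ⇒ A
    ρ⇐ : ∀ {A} → A ⇒ A ⊗₀ I
    ρ-isoˡ : ∀ {A} → ρ⇐ ∘ ρ⇒ {A} ≡ id
    ρ-isoʳ : ∀ {A} → ρ⇒ ∘ ρ⇐ {A} ≡ id
    ρ-natural : ∀ {A A′} {f : A ⇒ A′} → ρ⇒ ∘ (f ⊗₁ id) ≡ f ∘ ρ⇒
    σ : ∀ {A B} → A ⊗₀ B ⇒ B ⊗₀ A
    σ-natural : ∀ {A A′ B B′} {f : A ⇒ A′} {g : B ⇒ B′} →
                σ ∘ (f ⊗₁ g) ≡ (g ⊗₁ f) ∘ σ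
    σ-involutive : ∀ {A B} → σ {B} {A} ∘ σ {A} {B} ≡ id
    pentagon : ∀ {A B C D} →
      (id {A} ⊗₁ α⇒ {B} {C} {D}) ∘ (α⇒ ∘ (α⇒ ⊗₁ id)) ≡ α⇒ ∘ α⇒
    triangle : ∀ {A B} → (id {A} ⊗₁ λ⇒ {B}) ∘ α⇒ ≡ ρ⇒ ⊗₁ id
    hexagon : ∀ {A B C} →
      (id {B} ⊗₁ σ {A} {C}) ∘ (α⇒ ∘ (σ ⊗₁ id)) ≡ α⇒ ∘ (σ ∘ α⇒)
    copy : ∀ {A} → A ⇒ A ⊗₀ A
    del : ∀ {A} → A ⇒ I
    counitˡ : ∀ {A} → λ⇒ ∘ ((del ⊗₁ id) ∘ copy) ≡ id {A}
    counitʳ : ∀ {A} → ρ⇒ ∘ ((id ⊗₁ del) ∘ copy) ≡ id {A}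
    coassoc : ∀ {A} → α⇒ ∘ ((copy ⊗₁ id) ∘ copy) ≡ (id ⊗₁ copy) ∘ copy {A}
    cocomm : ∀ {A} → σ ∘ copy ≡ copy {A}
    -- compatibility with ⊗
    -- copy_{A⊗B} = (middle-four interchange) ∘ (copy_A ⊗ copy_B)
    copy-⊗ : ∀ {A B} → copy {A ⊗₀ B} ≡
      (α⇐ ∘ ((id ⊗₁ (α⇒ ∘ ((σ ⊗₁ id) ∘ α⇐))) ∘ α⇒)) ∘ (copy ⊗₁ copy)
    del-⊗ : ∀ {A B} → del {A ⊗₀ B} ≡ λ⇒ ∘ (del ⊗₁ del)
    del-I : del {I} ≡ id

Rel : Set → Set → Set₁
Rel A B = A → B → Set

infixr 9 _∘R_
_∘R_ : ∀ {A B C} → Rel B C → Rel A B → Rel A C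
(S ∘R R) a c = Σ[ b ∈ _ ] (R a b × S b c)

idR : ∀ {A} → Rel A A
idR a a′ = a ≡ a′

graph : ∀ {A B} → (A → B) → Rel A B
graph f a b = f a ≡ b

_×R_ : ∀ {A B C D} → Rel A B → Rel C D → Rel (A × C) (B × D)
(R ×R S) (a , c) (b , d) = R a b × S c d

infix 4 _≐_
_≐_ : ∀ {A B} → Rel A B → Rel A B → Set
R ≐ S = ∀ a b → R a b ⇔ S a b

IsFunction : ∀ {A B} → Rel A B → Set
IsFunction {A} {B} R = ∀ a → Σ[ b ∈ B ] (R a b × (∀ b′ → R a b′ → b ≡ b′))

Imitates : ∀ {A X} → Rel X X → Rel A X → Rel A X → Set
Imitates {A} {X} _≽_ ν μ = ∀ (a : A) → Σ[ u ∈ X ] μ a u →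
  (Σ[ enh ∈ (Σ[ u ∈ X ] μ a u → Σ[ v ∈ X ] ν a v) ]
     (∀ u → proj₁ (enh u) ≽ proj₁ u))
  ×
  (Σ[ deg ∈ (Σ[ v ∈ X ] ν a v → Σ[ u ∈ X ] μ a u) ]
     (∀ v → proj₁ v ≽ proj₁ (deg v)))

module _ {o h : Level} (𝒞 : GSMonoidalCategory o h) where
  open GSMonoidalCategory 𝒞

  dom : ∀ {A X} → A ⇒ X → A ⇒ A
  dom f = ρ⇒ ∘ ((id ⊗₁ (del ∘ f)) ∘ copy)

  Normalized : Set (o ⊔ h)
  Normalized = ∀ {A X} (f : A ⇒ X) → f ∘ dom f ≡ f

  Functional : ∀ {A X} → A ⇒ X → Set h
  Functional f = copy ∘ f ≡ (f ⊗₁ f) ∘ copy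

  record LaxGSFunctor : Set (lsuc (o ⊔ h)) where
    field
      Φ₀ : Obj → Set
      Φ₁ : ∀ {A B} → A ⇒ B → Rel (Φ₀ A) (Φ₀ B)
      Φ-id : ∀ {A} → Φ₁ (id {A}) ≐ idR
      Φ-∘ : ∀ {A B C} (f : A ⇒ B) (g : B ⇒ C) → Φ₁ (g ∘ f) ≐ Φ₁ g ∘R Φ₁ f
      ψ₀ : Rel ⊤ (Φ₀ I)
      ψ : ∀ {A B} → Rel (Φ₀ A × Φ₀ B) (Φ₀ (A ⊗₀ B))
      ψ-natural : ∀ {A A′ B B′} (f : A ⇒ A′) (g : B ⇒ B′) →
        Φ₁ (f ⊗₁ g) ∘R ψ ≐ ψ ∘R (Φ₁ f ×R Φ₁ g)
      ψ-assoc : ∀ {A B C} →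
        Φ₁ (α⇒ {A} {B} {C}) ∘R (ψ ∘R (ψ ×R idR))
          ≐ ψ ∘R ((idR ×R ψ) ∘R graph (λ { ((a , b) , c) → (a , (b , c)) }))
      ψ-unitˡ : ∀ {A} → Φ₁ (λ⇒ {A}) ∘R (ψ ∘R (ψ₀ ×R idR)) ≐ graph proj₂
      ψ-unitʳ : ∀ {A} → Φ₁ (ρ⇒ {A}) ∘R (ψ ∘R (idR ×R ψ₀)) ≐ graph proj₁
      ψ-sym : ∀ {A B} → Φ₁ (σ {A} {B}) ∘R ψ ≐ ψ ∘R graph swap
      Φ-copy : ∀ {A} → Φ₁ (copy {A}) ≐ ψ ∘R graph (λ a → (a , a))
      Φ-del : ∀ {A} → Φ₁ (del {A}) ≐ ψ₀ ∘R graph (λ _ → tt)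

  record TargetContextIB : Set (lsuc (o ⊔ h)) where
    field
      normalized : Normalized
      T Ctx B : Obj
      eval : T ⊗₀ Ctx ⇒ B
      Φ : LaxGSFunctor
    open LaxGSFunctor Φ
    field
      _≽_ : Rel (Φ₀ B) (Φ₀ B)
      ≽-refl : ∀ {x} → x ≽ x
      ≽-trans : ∀ {x y z} → x ≽ y → y ≽ z → x ≽ z
      eval-function : IsFunction (Φ₁ eval)
      -- f ⊒ g ⇒ f ≽ g  (ambient relation on 𝒞(A, T ⊗ C))
      ⊒⇒≽ : ∀ {A} (f g : A ⇒ T ⊗₀ Ctx) → f ∘ dom g ≡ g →
        Imitates _≽_ (Φ₁ eval ∘R Φ₁ f) (Φ₁ eval ∘R Φ₁ g)
      ≽-precomp : ∀ {A A′} (f g : A ⇒ T ⊗₀ Ctx) (k : A′ ⇒ A) →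
        Imitates _≽_ (Φ₁ eval ∘R Φ₁ f) (Φ₁ eval ∘R Φ₁ g) →
        Imitates _≽_ (Φ₁ eval ∘R Φ₁ (f ∘ k)) (Φ₁ eval ∘R Φ₁ (g ∘ k))

  module _ (S : TargetContextIB) where
    open TargetContextIB S
    open LaxGSFunctor Φ

    CompleteParametrization : ∀ {P} (A : Obj) → P ⊗₀ Ctx ⇒ B → Set h
    CompleteParametrization {P} A F = ∀ (f : A ⊗₀ Ctx ⇒ B) →
      Σ[ p ∈ A ⇒ P ] (Functional p × Imitates _≽_ (Φ₁ (F ∘ (p ⊗₁ id))) (Φ₁ f))

-- Lawvere's diagonal argument. Apply completeness to the diagonal f₀ = g ∘ F ∘ copy ∘ π₂ : A ⊗ C → B
-- to get a functional p : A → C with F ∘ (p ⊗ id) imitating f₀, and put b = F ∘ (p ⊗ id) ∘ ⟨id, p⟩, which equals F ∘ copy ∘ p.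
-- Precomposing both sides of the imitation with the functional map ⟨id, p⟩ = (id ⊗ p) ∘ copy turns
-- F ∘ (p ⊗ id) into b and f₀ into g ∘ b. Imitation survives this precomposition because f₀ is
-- defined wherever ⟨id, p⟩ lands while f₀ ∘ ⟨id, p⟩ is defined; this is where normalization enters.
module Submission where

open import Defs
open import Level using (Level)
open import Data.Product using (Σ-syntax; _×_; _,_; proj₁; proj₂)
open import Data.Unit using (tt)
open import Function using (Equivalence)
import Function.Properties.Equivalence as ⇔
open import Relation.Binary.PropositionalEquality
  using (_≡_; refl; sym; trans; cong; cong₂; subst; module ≡-Reasoning)

open Equivalence

module GSMonoidalProperties {o h : Level} (𝒞 : GSMonoidalCategory o h) where
  open GSMonoidalCategory 𝒞
  open ≡-Reasoning

  pullʳ : ∀ {W X Y Z} {f : X ⇒ Y} {g : W ⇒ X} {fg : W ⇒ Y} {k : Y ⇒ Z} →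
          f ∘ g ≡ fg → (k ∘ f) ∘ g ≡ k ∘ fg
  pullʳ {k = k} p = trans assoc (cong (k ∘_) p)

  pullˡ : ∀ {W X Y Z} {f : X ⇒ Y} {g : W ⇒ X} {fg : W ⇒ Y} {k : Z ⇒ W} →
          f ∘ g ≡ fg → f ∘ (g ∘ k) ≡ fg ∘ k
  pullˡ {k = k} p = trans (sym assoc) (cong (_∘ k) p)

  glue : ∀ {X X′ Y Y′ Z Z′} {a : X ⇒ Y} {x : X ⇒ X′} {y : Y ⇒ Y′} {a′ : X′ ⇒ Y′}
         {b : Y ⇒ Z} {z : Z ⇒ Z′} {b′ : Y′ ⇒ Z′} →
         a′ ∘ x ≡ y ∘ a → b′ ∘ y ≡ z ∘ b → (b′ ∘ a′) ∘ x ≡ z ∘ (b ∘ a)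
  glue {a = a} {b = b} {z = z} p q = begin
    _ ≡⟨ pullʳ p ⟩
    _ ≡⟨ pullˡ q ⟩
    (z ∘ b) ∘ a ≡⟨ assoc ⟩
    z ∘ (b ∘ a) ∎

  id⊗-∘ : ∀ {A X Y Z} {f : Y ⇒ Z} {g : X ⇒ Y} → (id {A} ⊗₁ f) ∘ (id ⊗₁ g) ≡ id ⊗₁ (f ∘ g)
  id⊗-∘ = trans (sym ⊗-∘) (cong (_⊗₁ _) identityˡ)

  ⊗-splitˡ : ∀ {A A′ X X′} {f : A ⇒ A′} {g : X ⇒ X′} → (f ⊗₁ id) ∘ (id ⊗₁ g) ≡ f ⊗₁ g
  ⊗-splitˡ = trans (sym ⊗-∘) (cong₂ _⊗₁_ identityʳ identityˡ)

  ⊗-splitʳ : ∀ {A A′ X X′} {f : A ⇒ A′} {g : X ⇒ X′} → (id ⊗₁ g) ∘ (f ⊗₁ id) ≡ f ⊗₁ g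
  ⊗-splitʳ = trans (sym ⊗-∘) (cong₂ _⊗₁_ identityˡ identityʳ)

  id⊗-square : ∀ {A A′ X X′ Y Y′} {f : A ⇒ A′} {s : X ⇒ Y} {s′ : X′ ⇒ Y′} {x : X ⇒ X′} {y : Y ⇒ Y′} →
               s′ ∘ x ≡ y ∘ s → (id ⊗₁ s′) ∘ (f ⊗₁ x) ≡ (f ⊗₁ y) ∘ (id ⊗₁ s)
  id⊗-square p = trans (sym ⊗-∘) (trans (cong₂ _⊗₁_ (trans identityˡ (sym identityʳ)) p) ⊗-∘)

  ⊗id-square : ∀ {A A′ X X′ Y Y′} {f : A ⇒ A′} {s : X ⇒ Y} {s′ : X′ ⇒ Y′} {x : X ⇒ X′} {y : Y ⇒ Y′} →
               s′ ∘ x ≡ y ∘ s → (s′ ⊗₁ id) ∘ (x ⊗₁ f) ≡ (y ⊗₁ f) ∘ (s ⊗₁ id)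
  ⊗id-square p = trans (sym ⊗-∘) (trans (cong₂ _⊗₁_ p (trans identityˡ (sym identityʳ))) ⊗-∘)

  α⇒-transpose : ∀ {A B C X} {u : X ⇒ (A ⊗₀ B) ⊗₀ C} {w : X ⇒ A ⊗₀ (B ⊗₀ C)} →
                 α⇒ ∘ u ≡ w → α⇐ ∘ w ≡ u
  α⇒-transpose {u = u} p = begin
    _ ≡⟨ cong (α⇐ ∘_) (sym p) ⟩
    _ ≡⟨ pullˡ α-isoˡ ⟩
    id ∘ u ≡⟨ identityˡ ⟩
    u ∎

  α⇐-natural : ∀ {A A′ B B′ C C′} {f : A ⇒ A′} {g : B ⇒ B′} {k : C ⇒ C′} →
               α⇐ ∘ (f ⊗₁ (g ⊗₁ k)) ≡ ((f ⊗₁ g) ⊗₁ k) ∘ α⇐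
  α⇐-natural {f = f} {g} {k} = α⇒-transpose (begin
    α⇒ ∘ (((f ⊗₁ g) ⊗₁ k) ∘ α⇐) ≡⟨ pullˡ α-natural ⟩
    ((f ⊗₁ (g ⊗₁ k)) ∘ α⇒) ∘ α⇐ ≡⟨ pullʳ α-isoʳ ⟩
    (f ⊗₁ (g ⊗₁ k)) ∘ id        ≡⟨ identityʳ ⟩
    f ⊗₁ (g ⊗₁ k)                ∎)

  swapInner : ∀ {A B C} → A ⊗₀ (B ⊗₀ C) ⇒ B ⊗₀ (A ⊗₀ C)
  swapInner = α⇒ ∘ ((σ ⊗₁ id) ∘ α⇐)

  swapInner-natural : ∀ {A A′ B B′ C C′} {f : A ⇒ A′} {g : B ⇒ B′} {k : C ⇒ C′} →
                      swapInner ∘ (f ⊗₁ (g ⊗₁ k)) ≡ (g ⊗₁ (f ⊗₁ k)) ∘ swapInner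
  swapInner-natural = glue (glue α⇐-natural (⊗id-square σ-natural)) α-natural

  shuffle : ∀ {A B C D} → (A ⊗₀ B) ⊗₀ (C ⊗₀ D) ⇒ (A ⊗₀ C) ⊗₀ (B ⊗₀ D)
  shuffle = α⇐ ∘ ((id ⊗₁ swapInner) ∘ α⇒)

  shuffle-natural : ∀ {A A′ B B′ C C′ D D′} {f : A ⇒ A′} {g : B ⇒ B′} {p : C ⇒ C′} {q : D ⇒ D′} →
                    shuffle ∘ ((f ⊗₁ g) ⊗₁ (p ⊗₁ q)) ≡ ((f ⊗₁ p) ⊗₁ (g ⊗₁ q)) ∘ shuffle
  shuffle-natural = glue (glue α-natural (id⊗-square swapInner-natural)) α⇐-natural

  copy³ : ∀ {A} → A ⇒ A ⊗₀ (A ⊗₀ A)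
  copy³ = (id ⊗₁ copy) ∘ copy

  swapInner-copy³ : ∀ {A} → swapInner ∘ copy³ {A} ≡ copy³
  swapInner-copy³ = begin
    (α⇒ ∘ ((σ ⊗₁ id) ∘ α⇐)) ∘ copy³       ≡⟨ pullʳ (pullʳ (α⇒-transpose coassoc)) ⟩
    α⇒ ∘ ((σ ⊗₁ id) ∘ ((copy ⊗₁ id) ∘ copy)) ≡⟨ cong (α⇒ ∘_) (pullˡ (sym ⊗-∘)) ⟩
    α⇒ ∘ (((σ ∘ copy) ⊗₁ (id ∘ id)) ∘ copy)  ≡⟨ cong (λ c → α⇒ ∘ (c ∘ copy)) (cong₂ _⊗₁_ cocomm identityˡ) ⟩
    α⇒ ∘ ((copy ⊗₁ id) ∘ copy)               ≡⟨ coassoc ⟩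
    copy³                                     ∎

  α⇒-copy⊗copy : ∀ {A} → α⇒ ∘ ((copy ⊗₁ copy) ∘ copy {A}) ≡ (id ⊗₁ copy³) ∘ copy
  α⇒-copy⊗copy = begin
    α⇒ ∘ ((copy ⊗₁ copy) ∘ copy)                                ≡⟨ cong (λ c → α⇒ ∘ (c ∘ copy)) (sym ⊗-splitʳ) ⟩
    α⇒ ∘ (((id ⊗₁ copy) ∘ (copy ⊗₁ id)) ∘ copy)                 ≡⟨ cong (λ c → α⇒ ∘ (((c ⊗₁ copy) ∘ (copy ⊗₁ id)) ∘ copy)) (sym ⊗-id) ⟩
    α⇒ ∘ ((((id ⊗₁ id) ⊗₁ copy) ∘ (copy ⊗₁ id)) ∘ copy)         ≡⟨ cong (α⇒ ∘_) assoc ⟩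
    α⇒ ∘ (((id ⊗₁ id) ⊗₁ copy) ∘ ((copy ⊗₁ id) ∘ copy))         ≡⟨ pullˡ α-natural ⟩
    ((id ⊗₁ (id ⊗₁ copy)) ∘ α⇒) ∘ ((copy ⊗₁ id) ∘ copy)         ≡⟨ pullʳ coassoc ⟩
    (id ⊗₁ (id ⊗₁ copy)) ∘ ((id ⊗₁ copy) ∘ copy)                ≡⟨ pullˡ id⊗-∘ ⟩
    (id ⊗₁ copy³) ∘ copy                                         ∎

  shuffle-copy⊗copy : ∀ {A} → shuffle ∘ ((copy ⊗₁ copy) ∘ copy {A}) ≡ (copy ⊗₁ copy) ∘ copy
  shuffle-copy⊗copy = begin
    (α⇐ ∘ ((id ⊗₁ swapInner) ∘ α⇒)) ∘ ((copy ⊗₁ copy) ∘ copy) ≡⟨ pullʳ (pullʳ α⇒-copy⊗copy) ⟩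
    α⇐ ∘ ((id ⊗₁ swapInner) ∘ ((id ⊗₁ copy³) ∘ copy))          ≡⟨ cong (α⇐ ∘_) (pullˡ id⊗-∘) ⟩
    α⇐ ∘ ((id ⊗₁ (swapInner ∘ copy³)) ∘ copy)                  ≡⟨ cong (λ c → α⇐ ∘ ((id ⊗₁ c) ∘ copy)) swapInner-copy³ ⟩
    α⇐ ∘ ((id ⊗₁ copy³) ∘ copy)                                ≡⟨ α⇒-transpose α⇒-copy⊗copy ⟩
    (copy ⊗₁ copy) ∘ copy                                       ∎

  Functional-id : ∀ {A} → Functional 𝒞 (id {A})
  Functional-id = trans identityʳ (trans (sym identityˡ) (cong (_∘ copy) (sym ⊗-id)))

  Functional-∘ : ∀ {A X Y} {f : A ⇒ X} {g : X ⇒ Y} →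
                 Functional 𝒞 f → Functional 𝒞 g → Functional 𝒞 (g ∘ f)
  Functional-∘ {f = f} {g} pf pg = begin
    copy ∘ (g ∘ f)                ≡⟨ pullˡ pg ⟩
    ((g ⊗₁ g) ∘ copy) ∘ f         ≡⟨ pullʳ pf ⟩
    (g ⊗₁ g) ∘ ((f ⊗₁ f) ∘ copy)  ≡⟨ pullˡ (sym ⊗-∘) ⟩
    ((g ∘ f) ⊗₁ (g ∘ f)) ∘ copy   ∎

  Functional-⊗ : ∀ {A X B Y} {f : A ⇒ X} {g : B ⇒ Y} →
                 Functional 𝒞 f → Functional 𝒞 g → Functional 𝒞 (f ⊗₁ g)
  Functional-⊗ {f = f} {g} pf pg = begin
    copy ∘ (f ⊗₁ g)                                 ≡⟨ cong (_∘ (f ⊗₁ g)) copy-⊗ ⟩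
    (shuffle ∘ (copy ⊗₁ copy)) ∘ (f ⊗₁ g)           ≡⟨ pullʳ (sym ⊗-∘) ⟩
    shuffle ∘ ((copy ∘ f) ⊗₁ (copy ∘ g))            ≡⟨ cong (shuffle ∘_) (trans (cong₂ _⊗₁_ pf pg) ⊗-∘) ⟩
    shuffle ∘ (((f ⊗₁ f) ⊗₁ (g ⊗₁ g)) ∘ (copy ⊗₁ copy)) ≡⟨ pullˡ shuffle-natural ⟩
    (((f ⊗₁ g) ⊗₁ (f ⊗₁ g)) ∘ shuffle) ∘ (copy ⊗₁ copy) ≡⟨ pullʳ (sym copy-⊗) ⟩
    ((f ⊗₁ g) ⊗₁ (f ⊗₁ g)) ∘ copy                    ∎

  Functional-copy : ∀ {A} → Functional 𝒞 (copy {A})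
  Functional-copy = trans (cong (_∘ copy) copy-⊗) (trans assoc shuffle-copy⊗copy)

  dom-∘-functional : ∀ {A Y Z} {k : A ⇒ Y} (f : Y ⇒ Z) → Functional 𝒞 k →
                     dom 𝒞 f ∘ k ≡ k ∘ dom 𝒞 (f ∘ k)
  dom-∘-functional {k = k} f pk = begin
    (ρ⇒ ∘ ((id ⊗₁ (del ∘ f)) ∘ copy)) ∘ k                ≡⟨ pullʳ (pullʳ pk) ⟩
    ρ⇒ ∘ ((id ⊗₁ (del ∘ f)) ∘ ((k ⊗₁ k) ∘ copy))          ≡⟨ cong (ρ⇒ ∘_) (pullˡ (trans (sym ⊗-∘) (cong₂ _⊗₁_ identityˡ assoc))) ⟩
    ρ⇒ ∘ ((k ⊗₁ (del ∘ f ∘ k)) ∘ copy)                    ≡⟨ cong (λ c → ρ⇒ ∘ (c ∘ copy)) (sym ⊗-splitˡ) ⟩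
    ρ⇒ ∘ (((k ⊗₁ id) ∘ (id ⊗₁ (del ∘ f ∘ k))) ∘ copy)    ≡⟨ cong (ρ⇒ ∘_) assoc ⟩
    ρ⇒ ∘ ((k ⊗₁ id) ∘ ((id ⊗₁ (del ∘ f ∘ k)) ∘ copy))    ≡⟨ pullˡ ρ-natural ⟩
    (k ∘ ρ⇒) ∘ ((id ⊗₁ (del ∘ f ∘ k)) ∘ copy)            ≡⟨ assoc ⟩
    k ∘ dom 𝒞 (f ∘ k)                                     ∎

  π₂ : ∀ {A X} → A ⊗₀ X ⇒ X
  π₂ = λ⇒ ∘ (del ⊗₁ id)

  ⟨id,_⟩ : ∀ {A X} → A ⇒ X → A ⇒ A ⊗₀ X
  ⟨id, p ⟩ = (id ⊗₁ p) ∘ copy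

  π₂-⟨id,_⟩ : ∀ {A X} (p : A ⇒ X) → π₂ ∘ ⟨id, p ⟩ ≡ p
  π₂-⟨id, p ⟩ = begin
    (λ⇒ ∘ (del ⊗₁ id)) ∘ ((id ⊗₁ p) ∘ copy)   ≡⟨ pullʳ (pullˡ (trans ⊗-splitˡ (sym ⊗-splitʳ))) ⟩
    λ⇒ ∘ (((id ⊗₁ p) ∘ (del ⊗₁ id)) ∘ copy)   ≡⟨ cong (λ⇒ ∘_) assoc ⟩
    λ⇒ ∘ ((id ⊗₁ p) ∘ ((del ⊗₁ id) ∘ copy))   ≡⟨ pullˡ λ-natural ⟩
    (p ∘ λ⇒) ∘ ((del ⊗₁ id) ∘ copy)           ≡⟨ pullʳ counitˡ ⟩
    p ∘ id                                    ≡⟨ identityʳ ⟩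
    p                                         ∎

  ⊗id-⟨id,_⟩ : ∀ {A X} {p : A ⇒ X} → Functional 𝒞 p → (p ⊗₁ id) ∘ ⟨id, p ⟩ ≡ copy ∘ p
  ⊗id-⟨id, fp ⟩ = trans (pullˡ ⊗-splitˡ) (sym fp)

  Functional-⟨id,_⟩ : ∀ {A X} {p : A ⇒ X} → Functional 𝒞 p → Functional 𝒞 ⟨id, p ⟩
  Functional-⟨id, fp ⟩ = Functional-∘ Functional-copy (Functional-⊗ Functional-id fp)

  diagonal-⟨id,_⟩ : ∀ {A X Y Z} {p : A ⇒ X} → Functional 𝒞 p → (F : X ⊗₀ X ⇒ Y) (g : Y ⇒ Z) →
                    g ∘ ((F ∘ (p ⊗₁ id)) ∘ ⟨id, p ⟩) ≡ (g ∘ (F ∘ (copy ∘ π₂))) ∘ ⟨id, p ⟩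
  diagonal-⟨id,_⟩ {p = p} fp F g = begin
    g ∘ ((F ∘ (p ⊗₁ id)) ∘ ⟨id, p ⟩)  ≡⟨ cong (g ∘_) (pullʳ (⊗id-⟨id, fp ⟩)) ⟩
    g ∘ (F ∘ (copy ∘ p))              ≡⟨ cong (λ q → g ∘ (F ∘ (copy ∘ q))) (sym (π₂-⟨id, p ⟩)) ⟩
    g ∘ (F ∘ (copy ∘ (π₂ ∘ ⟨id, p ⟩))) ≡⟨ cong (g ∘_) (cong (F ∘_) (sym assoc)) ⟩
    g ∘ (F ∘ ((copy ∘ π₂) ∘ ⟨id, p ⟩)) ≡⟨ cong (g ∘_) (sym assoc) ⟩
    g ∘ ((F ∘ (copy ∘ π₂)) ∘ ⟨id, p ⟩) ≡⟨ sym assoc ⟩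
    (g ∘ (F ∘ (copy ∘ π₂))) ∘ ⟨id, p ⟩ ∎

≐-sym : ∀ {A B} {R S : Rel A B} → R ≐ S → S ≐ R
≐-sym e a b = ⇔.sym (e a b)

≐-trans : ∀ {A B} {R S T : Rel A B} → R ≐ S → S ≐ T → R ≐ T
≐-trans e e′ a b = ⇔.trans (e a b) (e′ a b)

Imitates-resp-≐ : ∀ {A X} {_≽_ : Rel X X} {ν ν′ μ μ′ : Rel A X} →
                  ν ≐ ν′ → μ ≐ μ′ → Imitates _≽_ ν μ → Imitates _≽_ ν′ μ′
Imitates-resp-≐ eν eμ im a (u₀ , r₀) with im a (u₀ , from (eμ a u₀) r₀)
... | (enh , enh-≽) , (deg , deg-≽) =
  ((λ (u , r) → let (v , s) = enh (u , from (eμ a u) r) in v , to (eν a v) s) ,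
   (λ (u , r) → enh-≽ (u , from (eμ a u) r))) ,
  ((λ (v , s) → let (u , r) = deg (v , from (eν a v) s) in u , to (eμ a u) r) ,
   (λ (v , s) → deg-≽ (v , from (eν a v) s)))

-- The definedness hypothesis supplies the nonempty μ-image at x without which im x yields no degradation map.
Imitates-∘R : ∀ {A X Y} {_≽_ : Rel Y Y} {ν μ : Rel X Y} (κ : Rel A X) →
              (∀ {a x u} → (μ ∘R κ) a u → κ a x → Σ[ u′ ∈ Y ] μ x u′) →
              Imitates _≽_ ν μ → Imitates _≽_ (ν ∘R κ) (μ ∘R κ)
Imitates-∘R {_≽_ = _≽_} {ν = ν} {μ} κ defined im a (u₀ , r₀) = (enh , enh-≽) , (deg , deg-≽)
  where
  enh : Σ[ u ∈ _ ] (μ ∘R κ) a u → Σ[ v ∈ _ ] (ν ∘R κ) a v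
  enh (u , x , κax , μxu) =
    let (v , νxv) = proj₁ (proj₁ (im x (u , μxu))) (u , μxu) in v , x , κax , νxv
  enh-≽ : ∀ w → proj₁ (enh w) ≽ proj₁ w
  enh-≽ (u , x , κax , μxu) = proj₂ (proj₁ (im x (u , μxu))) (u , μxu)
  deg : Σ[ v ∈ _ ] (ν ∘R κ) a v → Σ[ u ∈ _ ] (μ ∘R κ) a u
  deg (v , x , κax , νxv) =
    let (u , μxu) = proj₁ (proj₂ (im x (defined r₀ κax))) (v , νxv) in u , x , κax , μxu
  deg-≽ : ∀ w → proj₁ w ≽ proj₁ (deg w)
  deg-≽ (v , x , κax , νxv) = proj₂ (proj₂ (im x (defined r₀ κax))) (v , νxv)

module LaxGSFunctorProperties {o h : Level} {𝒞 : GSMonoidalCategory o h} (Φ : LaxGSFunctor 𝒞) where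
  open GSMonoidalCategory 𝒞
  open LaxGSFunctor Φ
  open GSMonoidalProperties 𝒞 using (dom-∘-functional)

  Φ-resp-≡ : ∀ {X Y} {f f′ : X ⇒ Y} → f ≡ f′ → Φ₁ f ≐ Φ₁ f′
  Φ-resp-≡ refl x y = ⇔.refl

  Φ-del⇒ψ₀ : ∀ {Y} {y : Φ₀ Y} {i} → Φ₁ (del {Y}) y i → ψ₀ tt i
  Φ-del⇒ψ₀ r with to (Φ-del _ _) r
  ... | _ , refl , ψ₀i = ψ₀i

  Φ-copy⇒ψ-diag : ∀ {Y} {y : Φ₀ Y} {w} → Φ₁ (copy {Y}) y w → ψ (y , y) w
  Φ-copy⇒ψ-diag r with to (Φ-copy _ _) r
  ... | _ , refl , ψw = ψw

  -- Along the factorization dom f = ρ⇒ ∘ (id ⊗ (del ∘ f)) ∘ copy, the laxator ψ tracks the input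
  -- through copy, and the right unit law for ψ₀ returns it unchanged.
  Φ-dom⇒diag : ∀ {Y Z} (f : Y ⇒ Z) {y y′} → Φ₁ (dom 𝒞 f) y y′ → (y ≡ y′) × Σ[ z ∈ Φ₀ Z ] Φ₁ f y z
  Φ-dom⇒diag f {y} {y′} r =
    let (t , r₁ , rρ) = to (Φ-∘ ((id ⊗₁ (del ∘ f)) ∘ copy) ρ⇒ _ _) r
        (w , rc , rd) = to (Φ-∘ copy (id ⊗₁ (del ∘ f)) _ _) r₁
        ((y₁ , i) , (rid , rdf) , ψt) = to (ψ-natural id (del ∘ f) _ _) (w , Φ-copy⇒ψ-diag rc , rd)
        (z , rf , rdel) = to (Φ-∘ f del _ _) rdf
        y≡y₁ = to (Φ-id _ _) rid
        y₁≡y′ = to (ψ-unitʳ (y₁ , tt) y′) (t , ((y₁ , i) , (refl , Φ-del⇒ψ₀ rdel) , ψt) , rρ)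
    in trans y≡y₁ y₁≡y′ , z , rf

  Φ-dom-refl : ∀ {Y Z} (f : Y ⇒ Z) → f ∘ dom 𝒞 f ≡ f → ∀ {y z} → Φ₁ f y z → Φ₁ (dom 𝒞 f) y y
  Φ-dom-refl f normal {y} r =
    let (y′ , rd , _) = to (Φ-∘ (dom 𝒞 f) f _ _) (from (Φ-resp-≡ normal _ _) r)
    in subst (Φ₁ (dom 𝒞 f) y) (sym (proj₁ (Φ-dom⇒diag f rd))) rd

  Φ-defined-along-functional : ∀ {A Y Z} (f : Y ⇒ Z) {k : A ⇒ Y} → Functional 𝒞 k →
    (f ∘ k) ∘ dom 𝒞 (f ∘ k) ≡ f ∘ k →
    ∀ {a y z} → (Φ₁ f ∘R Φ₁ k) a z → Φ₁ k a y → Σ[ z′ ∈ Φ₀ Z ] Φ₁ f y z′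
  Φ-defined-along-functional {Z = Z} f {k} fk normal {a} {y} r rk =
    let rdom = Φ-dom-refl (f ∘ k) normal (from (Φ-∘ k f _ _) r)
        (y′ , rk′ , rd) = to (Φ-∘ k (dom 𝒞 f) _ _)
          (from (Φ-resp-≡ (dom-∘-functional f fk) _ _) (from (Φ-∘ (dom 𝒞 (f ∘ k)) k _ _) (a , rdom , rk)))
        (y′≡y , defined) = Φ-dom⇒diag f rd
    in subst (λ y″ → Σ[ z′ ∈ Φ₀ Z ] Φ₁ f y″ z′) y′≡y defined

mainTheorem4 : ∀ {o h : Level} (𝒞 : GSMonoidalCategory o h) (S : TargetContextIB 𝒞) →
    let open GSMonoidalCategory 𝒞
        open TargetContextIB S
        open LaxGSFunctor Φ
    in ∀ (A : Obj) (F : Ctx ⊗₀ Ctx ⇒ B) → CompleteParametrization 𝒞 S A F →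
       ∀ (g : B ⇒ B) → Σ[ X ∈ Obj ] Σ[ b ∈ X ⇒ B ] Imitates _≽_ (Φ₁ b) (Φ₁ g ∘R Φ₁ b)
mainTheorem4 𝒞 S A F complete g =
  A , b , Imitates-resp-≐ {_≽_ = _≽_} b-unfolds g∘b-unfolds
            (Imitates-∘R {_≽_ = _≽_} (Φ₁ ⟨id, p ⟩)
              (Φ-defined-along-functional f₀ (Functional-⟨id, fp ⟩) (normalized (f₀ ∘ ⟨id, p ⟩)))
              G-imitates-f₀)
  where
  open GSMonoidalCategory 𝒞
  open TargetContextIB S
  open LaxGSFunctor Φ
  open GSMonoidalProperties 𝒞
  open LaxGSFunctorProperties Φ
  f₀ : A ⊗₀ Ctx ⇒ B
  f₀ = g ∘ (F ∘ (copy ∘ π₂))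
  p : A ⇒ Ctx
  p = proj₁ (complete f₀)
  fp : Functional 𝒞 p
  fp = proj₁ (proj₂ (complete f₀))
  G : A ⊗₀ Ctx ⇒ B
  G = F ∘ (p ⊗₁ id)
  G-imitates-f₀ : Imitates _≽_ (Φ₁ G) (Φ₁ f₀)
  G-imitates-f₀ = proj₂ (proj₂ (complete f₀))
  b : A ⇒ B
  b = G ∘ ⟨id, p ⟩
  b-unfolds : Φ₁ G ∘R Φ₁ ⟨id, p ⟩ ≐ Φ₁ b
  b-unfolds = ≐-sym (Φ-∘ ⟨id, p ⟩ G)
  g∘b-unfolds : Φ₁ f₀ ∘R Φ₁ ⟨id, p ⟩ ≐ Φ₁ g ∘R Φ₁ b
  g∘b-unfolds = ≐-trans (≐-sym (Φ-∘ ⟨id, p ⟩ f₀))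
                  (≐-trans (Φ-resp-≡ (sym (diagonal-⟨id, fp ⟩ F g))) (Φ-∘ b g))
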